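{- Let $S$ be an inverse-closed set of distinct non-zero integers. If $\mathrm{Cay}(\mathbb{Z}, S)$ is Hamilton-decomposable, then (i) $S=\emptyset$ or $\gcd(S) = 1$; and (ii) if $S$ is finite, then $\sum_{a \in S^+} a \equiv |S^+| \pmod 2$.
   Context: For an inverse-closed set $S$ of distinct non-zero integers (i.e. $s\in S$ iff $-s\in S$), $\mathrm{Cay}(\mathbb{Z},S)$ is the simple graph with vertex set $\mathbb{Z}$ and edge set $\{\{g,g+s\} : g\in\mathbb{Z}, s\in S\}$, and $S^+=\{a\in S : a>0\}$. A (two-way-infinite) Hamilton path of an infinite graph is a connected spanning $2$-valent subgraph. A Hamilton decomposition of an infinite graph is a set of pairwise edge-disjoint Hamilton paths whose union contains all edges; a graph is Hamilton-decomposable if it has one. -}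

module Defs where

open import Data.Nat using (ℕ)
open import Data.Integer using (ℤ; +_; _+_; _-_; -_; _<?_; ∣_∣; 0ℤ)
open import Data.Integer.Divisibility using (_∣_)
open import Data.List using (List; foldr; filter; length)
open import Data.List.Membership.Propositional using (_∈_)
open import Data.List.Relation.Unary.Unique.Propositional using (Unique)
open import Data.Product using (Σ; ∃; _×_)
open import Data.Sum using (_⊎_)
open import Relation.Nullary using (¬_)
open import Relation.Binary.PropositionalEquality using (_≡_; _≢_)
open import Relation.Binary.Construct.Closure.ReflexiveTransitive using (Star)

ZSet : Set₁
ZSet = ℤ → Set

InverseClosed : ZSet → Set
InverseClosed S = ∀ s → (S s → S (- s)) × (S (- s) → S s)

NonZeroSet : ZSet → Set
NonZeroSet S = ∀ s → S s → s ≢ 0ℤ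

CayAdj : ZSet → ℤ → ℤ → Set
CayAdj S u v = S (v - u)

-- A spanning subgraph of Cay(ℤ,S), given by its (symmetric) edge relation;
-- the vertex set is all of ℤ.
record IsSubgraph (S : ZSet) (H : ℤ → ℤ → Set) : Set where
  field
    symm : ∀ u v → H u v → H v u
    sub  : ∀ u v → H u v → CayAdj S u v

TwoValent : (ℤ → ℤ → Set) → Set
TwoValent H = ∀ v → Σ ℤ λ a → Σ ℤ λ b →
  a ≢ b × H v a × H v b × (∀ c → H v c → c ≡ a ⊎ c ≡ b)

Connected : (ℤ → ℤ → Set) → Set
Connected H = ∀ u v → Star H u v

-- (Two-way-infinite) Hamilton path: connected spanning 2-valent subgraph.
IsHamiltonPath : ZSet → (ℤ → ℤ → Set) → Set
IsHamiltonPath S H = IsSubgraph S H × TwoValent H × Connected H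

IsHamiltonDecomposition : (S : ZSet) (I : Set) → (I → ℤ → ℤ → Set) → Set
IsHamiltonDecomposition S I P =
  (∀ i → IsHamiltonPath S (P i)) ×
  (∀ i j u v → P i u v → P j u v → i ≡ j) ×
  (∀ u v → CayAdj S u v → ∃ λ i → P i u v)

HamiltonDecomposable : ZSet → Set₁
HamiltonDecomposable S = Σ Set λ I → Σ (I → ℤ → ℤ → Set) λ P →
  IsHamiltonDecomposition S I P

GcdOne : ZSet → Set
GcdOne S = ∀ (d : ℕ) → (∀ s → S s → + d ∣ s) → d ≡ 1

sumℤ : List ℤ → ℤ
sumℤ = foldr _+_ 0ℤ

positives : List ℤ → List ℤ
positives = filter (λ x → 0ℤ <? x)

-- L enumerates S without repetition (witnesses that S is finite).
Enumerates : ZSet → List ℤ → Set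
Enumerates S L = Unique L × (∀ x → (S x → x ∈ L) × (x ∈ L → S x))

FiniteParity : ZSet → Set
FiniteParity S = ∀ (L : List ℤ) → Enumerates S L →
  + 2 ∣ (sumℤ (positives L) - + length (positives L))

-- (i) A Hamilton path containing an edge at 0 is connected, so it walks from 0 to 1 in steps
-- taken from S; any common divisor of S therefore divides 1.
--
-- (ii) A two-way-infinite Hamilton path is a bijection w : ℤ → ℤ whose consecutive values are
-- adjacent. Only finitely many edges of Cay(ℤ,S) cross the cut between {x ≤ 0} and {x > 0} —
-- exactly Σ_{a ∈ S⁺} a of them — so w changes side only finitely often; being surjective, w
-- ends on opposite sides, hence every path of the decomposition contains an odd number of cut
-- edges. Every path also contains exactly two edges at 0. Weighting cut edges by 2 and edges at
-- 0 by 1, each path therefore has weight 2·odd + 2 ≡ 0 (mod 4), so 2 Σ_{a ∈ S⁺} a + |S| ≡ 0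
-- (mod 4); since |S| = 2|S⁺| the claim follows. The weighting avoids counting the paths.
module Submission where

open import Defs
open import Data.Integer using (ℤ)
open import Data.Product using (∃; _×_)

open import Data.Empty using (⊥)
open import Data.Integer as ℤ using (+_; -[1+_]; _+_; _-_; -_; 0ℤ; 1ℤ; ∣_∣)
import Data.Integer.Divisibility as ℤ∣
import Data.Integer.Divisibility.Signed as ℤ∣ₛ
import Data.Integer.Properties as ℤ
open import Data.Integer.Tactic.RingSolver using (solve-∀)
open import Data.List using (List; []; _∷_; _++_; map; filter; length; downFrom; upTo)
open import Data.List.Membership.DecPropositional ℤ._≟_ using (_∈?_)
open import Data.List.Membership.Propositional using (_∈_)
open import Data.List.Membership.Propositional.Properties
  using (∈-filter⁻; ∈-filter⁺; ∈-++⁻; ∈-++⁺ˡ; ∈-++⁺ʳ; ∈-map⁻; ∈-map⁺)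
open import Data.List.Membership.Propositional.Properties using (∈-downFrom⁻; ∈-downFrom⁺; ∈-upTo⁻; ∈-upTo⁺)
open import Data.List.Membership.Propositional.Properties.WithK using (unique∧set⇒bag)
open import Data.List.Properties
  using (filter-reject; filter-++; filter-≐; length-filter; length-++; length-map; length-downFrom)
open import Data.List.Relation.Binary.BagAndSetEquality using (∼bag⇒↭)
open import Data.List.Relation.Binary.Permutation.Propositional.Properties using (↭-length)
open import Data.List.Relation.Unary.All as All using (All; []; _∷_)
open import Data.List.Relation.Unary.All.Properties using (all-filter)
open import Data.List.Relation.Unary.AllPairs using ([]; _∷_)
open import Data.List.Relation.Unary.Any using (here; there)
open import Data.List.Relation.Unary.Unique.Propositional using (Unique)
import Data.List.Relation.Unary.Unique.Propositional.Properties as Unique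
open import Data.Nat as ℕ using (ℕ; zero; suc; z≤n; s≤s)
import Data.Nat.Divisibility as ℕ∣
open import Data.Nat.GeneralisedArithmetic using (fold)
open import Data.Nat.ListAction using (sum)
import Data.Nat.Properties as ℕ
import Data.Nat.Tactic.RingSolver as ℕ-Solver
open import Data.Parity.Base as ℙ using (Parity; 0ℙ; 1ℙ)
import Data.Parity.Properties as ℙ
open import Data.Product using (_,_; proj₁; proj₂)
open import Data.Sum as Sum using (_⊎_; inj₁; inj₂)
open import Function using (_∘_; _⇔_; Equivalence; mk⇔)
open import Relation.Binary.Construct.Closure.ReflexiveTransitive using (Star; ε; _◅_)
open import Relation.Binary.Definitions using (Symmetric; Transitive) renaming (Decidable to Decidable₂)
open import Relation.Binary.PropositionalEquality
open import Relation.Nullary using (¬_; yes; no; ¬?; contradiction)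
open import Relation.Nullary.Decidable using (map′)
open import Relation.Unary using (Decidable)

module _ {A : Set} where

  length-cong-unique : {xs ys : List A} → Unique xs → Unique ys →
                       (∀ {z} → z ∈ xs ⇔ z ∈ ys) → length xs ≡ length ys
  length-cong-unique uxs uys xs≐ys = ↭-length (∼bag⇒↭ (unique∧set⇒bag uxs uys xs≐ys))

  module _ {P : A → Set} (P? : Decidable P) where

    length-filter-split : ∀ xs → length xs ≡ length (filter P? xs) ℕ.+ length (filter (¬? ∘ P?) xs)
    length-filter-split []       = refl
    length-filter-split (x ∷ xs) with P? x
    ... | yes _ = cong suc (length-filter-split xs)
    ... | no  _ = trans (cong suc (length-filter-split xs)) (sym (ℕ.+-suc _ _))

    filter-filter-⊆ : {Q : A → Set} (Q? : Decidable Q) → (∀ {y} → P y → Q y) →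
                      ∀ xs → filter P? (filter Q? xs) ≡ filter P? xs
    filter-filter-⊆ Q? P⊆Q [] = refl
    filter-filter-⊆ Q? P⊆Q (x ∷ xs) with Q? x
    ... | yes _ with P? x
    ...   | yes _ = cong (x ∷_) (filter-filter-⊆ Q? P⊆Q xs)
    ...   | no  _ = filter-filter-⊆ Q? P⊆Q xs
    filter-filter-⊆ Q? P⊆Q (x ∷ xs) | no ¬q with P? x
    ...   | yes p = contradiction (P⊆Q p) ¬q
    ...   | no  _ = filter-filter-⊆ Q? P⊆Q xs

  module _ {R : A → A → Set} (R? : Decidable₂ R) (R-sym : Symmetric R) (R-trans : Transitive R) where

    ∣classes⇒∣length : ∀ m xs → (∀ {x} → x ∈ xs → R x x) →
                       (∀ {x} → x ∈ xs → m ℕ∣.∣ length (filter (R? x) xs)) → m ℕ∣.∣ length xs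
    ∣classes⇒∣length m xs = go (length xs) xs ℕ.≤-refl
      where
      -- Recursion on a length bound: the recursive call drops the whole class of the head.
      go : ∀ n xs → length xs ℕ.≤ n → (∀ {x} → x ∈ xs → R x x) →
           (∀ {x} → x ∈ xs → m ℕ∣.∣ length (filter (R? x) xs)) → m ℕ∣.∣ length xs
      go _ [] _ _ _ = m ℕ∣.∣0
      go (suc n) (x ∷ xs) (s≤s ∣xs∣≤n) refl-on class-∣ =
        subst (m ℕ∣.∣_) (sym (length-filter-split (R? x) (x ∷ xs)))
          (ℕ∣.∣m∣n⇒∣m+n (class-∣ (here refl)) (subst (λ l → m ℕ∣.∣ length l) (sym rest≡) rest-∣))
        where
        rest = filter (¬? ∘ R? x) xs
        rest≡ : filter (¬? ∘ R? x) (x ∷ xs) ≡ rest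
        rest≡ = filter-reject (¬? ∘ R? x) (λ ¬Rxx → ¬Rxx (refl-on (here refl)))
        ∈-rest⁻ : ∀ {z} → z ∈ rest → z ∈ xs × ¬ R x z
        ∈-rest⁻ = ∈-filter⁻ (¬? ∘ R? x) {xs = xs}
        class-in-rest : ∀ {z} → z ∈ rest → filter (R? z) rest ≡ filter (R? z) (x ∷ xs)
        class-in-rest z∈ = trans (cong (filter (R? _)) (sym rest≡))
          (filter-filter-⊆ (R? _) (¬? ∘ R? x)
            (λ Rzy Rxy → proj₂ (∈-rest⁻ z∈) (R-trans Rxy (R-sym Rzy))) (x ∷ xs))
        rest-∣ : m ℕ∣.∣ length rest
        rest-∣ = go n rest (ℕ.≤-trans (length-filter (¬? ∘ R? x) xs) ∣xs∣≤n)
          (λ z∈ → refl-on (there (proj₁ (∈-rest⁻ z∈))))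
          (λ z∈ → subst (λ l → m ℕ∣.∣ length l) (sym (class-in-rest z∈))
                    (class-∣ (there (proj₁ (∈-rest⁻ z∈)))))

length-filter-map : ∀ {A B : Set} {P : B → Set} (P? : Decidable P) (f : A → B) xs →
                    length (filter P? (map f xs)) ≡ length (filter (P? ∘ f) xs)
length-filter-map P? f []       = refl
length-filter-map P? f (x ∷ xs) with P? (f x)
... | yes _ = cong suc (length-filter-map P? f xs)
... | no  _ = length-filter-map P? f xs

∣∣≤sum : ∀ {x} xs → x ∈ xs → ∣ x ∣ ℕ.≤ sum (map ∣_∣ xs)
∣∣≤sum (y ∷ ys) (here refl)  = ℕ.m≤m+n ∣ y ∣ _
∣∣≤sum (y ∷ ys) (there x∈ys) = ℕ.≤-trans (∣∣≤sum ys x∈ys) (ℕ.m≤n+m _ ∣ y ∣)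

parity-suc : ∀ n → ℕ.parity (suc n) ≡ ℕ.parity n ℙ.⁻¹
parity-suc n = sym (ℙ.⁻¹-selfInverse (ℙ.suc-homo-⁻¹ n))

odd⇒2∣suc : ∀ n → ℕ.parity n ≡ 1ℙ → 2 ℕ∣.∣ suc n
odd⇒2∣suc zero ()
odd⇒2∣suc (suc zero)    _   = ℕ∣.∣-refl
odd⇒2∣suc (suc (suc n)) odd = ℕ∣.∣m∣n⇒∣m+n (ℕ∣.∣-refl {2}) (odd⇒2∣suc n odd)

≢1ℙ⇒≡0ℙ : ∀ {p} → p ≢ 1ℙ → p ≡ 0ℙ
≢1ℙ⇒≡0ℙ {0ℙ} _     = refl
≢1ℙ⇒≡0ℙ {1ℙ} p≢1ℙ = contradiction refl p≢1ℙ

+≢1ℙ⇒≡ : ∀ {p q} → p ℙ.+ q ≢ 1ℙ → p ≡ q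
+≢1ℙ⇒≡ {p} {q} p+q≢1ℙ = ℙ.+-cancelʳ-≡ q p q (trans (≢1ℙ⇒≡0ℙ p+q≢1ℙ) (sym (ℙ.p+p≡0ℙ q)))

≢⇒+≡1ℙ : ∀ {p q} → p ≢ q → p ℙ.+ q ≡ 1ℙ
≢⇒+≡1ℙ {0ℙ} {0ℙ} p≢q = contradiction refl p≢q
≢⇒+≡1ℙ {0ℙ} {1ℙ} _   = refl
≢⇒+≡1ℙ {1ℙ} {0ℙ} _   = refl
≢⇒+≡1ℙ {1ℙ} {1ℙ} p≢q = contradiction refl p≢q

telescope : ∀ p q r → (p ℙ.+ q) ℙ.+ (q ℙ.+ r) ≡ p ℙ.+ r
telescope p q r = begin
  (p ℙ.+ q) ℙ.+ (q ℙ.+ r) ≡⟨ ℙ.+-assoc p q (q ℙ.+ r) ⟩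
  p ℙ.+ (q ℙ.+ (q ℙ.+ r)) ≡⟨ cong (p ℙ.+_) (sym (ℙ.+-assoc q q r)) ⟩
  p ℙ.+ ((q ℙ.+ q) ℙ.+ r) ≡⟨ cong (λ x → p ℙ.+ (x ℙ.+ r)) (ℙ.p+p≡0ℙ q) ⟩
  p ℙ.+ r                 ∎
  where open ≡-Reasoning

u+[v-u]≡v : ∀ u v → u + (v - u) ≡ v
u+[v-u]≡v = solve-∀

[u+a]-u≡a : ∀ u a → (u + a) - u ≡ a
[u+a]-u≡a = solve-∀

_⊕_ : ℤ → ℕ → ℤ
i ⊕ zero  = i
i ⊕ suc n = ℤ.suc (i ⊕ n)

suc⊕ : ∀ i n → ℤ.suc i ⊕ n ≡ i ⊕ suc n
suc⊕ i zero    = refl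
suc⊕ i (suc n) = cong ℤ.suc (suc⊕ i n)

⊕≡+ : ∀ i n → i ⊕ n ≡ i + + n
⊕≡+ i zero    = sym (ℤ.+-identityʳ i)
⊕≡+ i (suc n) = trans (cong ℤ.suc (⊕≡+ i n)) (shift i (+ n))
  where
  shift : ∀ i x → 1ℤ + (i + x) ≡ i + (1ℤ + x)
  shift = solve-∀

⊕-reach : ∀ i j → (∃ λ n → j ≡ i ⊕ n) ⊎ (∃ λ n → i ≡ j ⊕ n)
⊕-reach i j with j - i in j-i≡
... | + n      = inj₁ (n , trans (sym (u+[v-u]≡v i j)) (trans (cong (λ x → i + x) j-i≡) (sym (⊕≡+ i n))))
... | -[1+ n ] = inj₂ (suc n , trans (sym (j-[j-i]≡i i j)) (trans (cong (λ x → j - x) j-i≡) (sym (⊕≡+ j (suc n)))))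
  where
  j-[j-i]≡i : ∀ i j → j - (j - i) ≡ i
  j-[j-i]≡i = solve-∀

-- The list [-n, n) of integers.
centredRange : ℕ → List ℤ
centredRange n = map -[1+_] (downFrom n) ++ map +_ (downFrom n)

∈-centredRange : ∀ {n k} → ∣ k ∣ ℕ.≤ n → ∣ ℤ.suc k ∣ ℕ.≤ n → k ∈ centredRange n
∈-centredRange {n} {+ m}      _     ∣k+1∣≤n =
  ∈-++⁺ʳ (map -[1+_] (downFrom n)) (∈-map⁺ +_ (∈-downFrom⁺ ∣k+1∣≤n))
∈-centredRange {n} { -[1+ m ]} ∣k∣≤n _       = ∈-++⁺ˡ (∈-map⁺ -[1+_] (∈-downFrom⁺ ∣k∣≤n))

centredRange-unique : ∀ n → Unique (centredRange n)
centredRange-unique n = Unique.++⁺ (Unique.map⁺ -[1+-injective (Unique.downFrom⁺ n))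
                                   (Unique.map⁺ ℤ.+-injective (Unique.downFrom⁺ n)) neg∩pos
  where
  -[1+-injective : ∀ {m n} → -[1+ m ] ≡ -[1+ n ] → m ≡ n
  -[1+-injective refl = refl
  neg∩pos : ∀ {k} → ¬ (k ∈ map -[1+_] (downFrom n) × k ∈ map +_ (downFrom n))
  neg∩pos (k∈neg , k∈pos) with ∈-map⁻ -[1+_] k∈neg | ∈-map⁻ +_ k∈pos
  ... | _ , _ , refl | _ , _ , ()

bounded-on-ball : (f : ℤ → ℤ) (r : ℕ) → ∃ λ B → ∀ {x} → ∣ x ∣ ℕ.≤ r → ∣ f x ∣ ℕ.≤ B
bounded-on-ball f r = sum (map ∣_∣ (map f (centredRange (suc r)))) , λ {x} ∣x∣≤r →
  ∣∣≤sum (map f (centredRange (suc r)))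
    (∈-map⁺ f (∈-centredRange (ℕ.m≤n⇒m≤1+n ∣x∣≤r)
                              (ℕ.≤-trans (ℤ.∣i+j∣≤∣i∣+∣j∣ 1ℤ x) (s≤s ∣x∣≤r))))

-- Sign changes of a two-sided sequence

module SignChanges (σ : ℤ → Parity) where

  Jump : ℤ → Set
  Jump k = σ k ℙ.+ σ (ℤ.suc k) ≡ 1ℙ

  jump? : Decidable Jump
  jump? k = σ k ℙ.+ σ (ℤ.suc k) ℙ.≟ 1ℙ

  jumps : List ℤ → ℕ
  jumps ks = length (filter jump? ks)

  parity-jumps-∷ : ∀ k ks → ℕ.parity (jumps (k ∷ ks)) ≡ (σ k ℙ.+ σ (ℤ.suc k)) ℙ.+ ℕ.parity (jumps ks)
  parity-jumps-∷ k ks with jump? k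
  ... | yes jump = trans (parity-suc (jumps ks)) (cong (ℙ._+ ℕ.parity (jumps ks)) (sym jump))
  ... | no ¬jump = cong (ℙ._+ ℕ.parity (jumps ks)) (sym (≢1ℙ⇒≡0ℙ ¬jump))

  parity-jumps-pos : ∀ n → ℕ.parity (jumps (map +_ (downFrom n))) ≡ σ 0ℤ ℙ.+ σ (+ n)
  parity-jumps-pos zero    = sym (ℙ.p+p≡0ℙ (σ 0ℤ))
  parity-jumps-pos (suc n) = begin
    ℕ.parity (jumps (+ n ∷ map +_ (downFrom n)))
      ≡⟨ parity-jumps-∷ (+ n) _ ⟩
    (σ (+ n) ℙ.+ σ (+ suc n)) ℙ.+ ℕ.parity (jumps (map +_ (downFrom n)))
      ≡⟨ cong ((σ (+ n) ℙ.+ σ (+ suc n)) ℙ.+_) (parity-jumps-pos n) ⟩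
    (σ (+ n) ℙ.+ σ (+ suc n)) ℙ.+ (σ 0ℤ ℙ.+ σ (+ n))
      ≡⟨ ℙ.+-comm _ (σ 0ℤ ℙ.+ σ (+ n)) ⟩
    (σ 0ℤ ℙ.+ σ (+ n)) ℙ.+ (σ (+ n) ℙ.+ σ (+ suc n))
      ≡⟨ telescope (σ 0ℤ) (σ (+ n)) (σ (+ suc n)) ⟩
    σ 0ℤ ℙ.+ σ (+ suc n) ∎
    where open ≡-Reasoning

  parity-jumps-neg : ∀ n → ℕ.parity (jumps (map -[1+_] (downFrom n))) ≡ σ (- + n) ℙ.+ σ 0ℤ
  parity-jumps-neg zero    = sym (ℙ.p+p≡0ℙ (σ 0ℤ))
  parity-jumps-neg (suc n) = begin
    ℕ.parity (jumps (-[1+ n ] ∷ map -[1+_] (downFrom n)))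
      ≡⟨ parity-jumps-∷ -[1+ n ] _ ⟩
    (σ -[1+ n ] ℙ.+ σ (ℤ.suc -[1+ n ])) ℙ.+ ℕ.parity (jumps (map -[1+_] (downFrom n)))
      ≡⟨ cong₂ (λ x y → (σ -[1+ n ] ℙ.+ σ x) ℙ.+ y) (ℤ.1-[1+n]≡-n n) (parity-jumps-neg n) ⟩
    (σ -[1+ n ] ℙ.+ σ (- + n)) ℙ.+ (σ (- + n) ℙ.+ σ 0ℤ)
      ≡⟨ telescope (σ -[1+ n ]) (σ (- + n)) (σ 0ℤ) ⟩
    σ -[1+ n ] ℙ.+ σ 0ℤ ∎
    where open ≡-Reasoning

  parity-jumps-centredRange : ∀ n → ℕ.parity (jumps (centredRange n)) ≡ σ (- + n) ℙ.+ σ (+ n)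
  parity-jumps-centredRange n = begin
    ℕ.parity (jumps (centredRange n))
      ≡⟨ cong (ℕ.parity ∘ length) (filter-++ jump? (map -[1+_] (downFrom n)) (map +_ (downFrom n))) ⟩
    ℕ.parity (length (filter jump? (map -[1+_] (downFrom n)) ++ filter jump? (map +_ (downFrom n))))
      ≡⟨ cong ℕ.parity (length-++ (filter jump? (map -[1+_] (downFrom n)))) ⟩
    ℕ.parity (jumps (map -[1+_] (downFrom n)) ℕ.+ jumps (map +_ (downFrom n)))
      ≡⟨ ℙ.+-homo-+ (jumps (map -[1+_] (downFrom n))) _ ⟩
    ℕ.parity (jumps (map -[1+_] (downFrom n))) ℙ.+ ℕ.parity (jumps (map +_ (downFrom n)))
      ≡⟨ cong₂ ℙ._+_ (parity-jumps-neg n) (parity-jumps-pos n) ⟩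
    (σ (- + n) ℙ.+ σ 0ℤ) ℙ.+ (σ 0ℤ ℙ.+ σ (+ n))
      ≡⟨ telescope (σ (- + n)) (σ 0ℤ) (σ (+ n)) ⟩
    σ (- + n) ℙ.+ σ (+ n) ∎
    where open ≡-Reasoning

  module _ {N : ℕ} (jump-bounded : ∀ k → Jump k → ∣ k ∣ ℕ.≤ N × ∣ ℤ.suc k ∣ ℕ.≤ N) where

    jump∈centredRange : ∀ {k} → Jump k → k ∈ centredRange N
    jump∈centredRange {k} jump = ∈-centredRange (proj₁ (jump-bounded k jump)) (proj₂ (jump-bounded k jump))

    private
      no-jump-beyond : ∀ {k} → N ℕ.< ∣ ℤ.suc k ∣ ⊎ N ℕ.< ∣ k ∣ → σ k ≡ σ (ℤ.suc k)
      no-jump-beyond {k} (inj₁ far) = +≢1ℙ⇒≡ λ jump → ℕ.<⇒≱ far (proj₂ (jump-bounded k jump))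
      no-jump-beyond {k} (inj₂ far) = +≢1ℙ⇒≡ λ jump → ℕ.<⇒≱ far (proj₁ (jump-bounded k jump))

    constant-pos : ∀ d → σ (+ (d ℕ.+ N)) ≡ σ (+ N)
    constant-pos zero    = refl
    constant-pos (suc d) = trans (sym (no-jump-beyond (inj₁ (s≤s (ℕ.m≤n+m N d))))) (constant-pos d)

    constant-neg : ∀ d → σ (- + (d ℕ.+ N)) ≡ σ (- + N)
    constant-neg zero    = refl
    constant-neg (suc d) =
      trans (trans (no-jump-beyond (inj₂ (s≤s (ℕ.m≤n+m N d)))) (cong σ (ℤ.1-[1+n]≡-n (d ℕ.+ N))))
            (constant-neg d)

    constant-beyond : ∀ {k} → N ℕ.< ∣ k ∣ → σ k ≡ σ (+ N) ⊎ σ k ≡ σ (- + N)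
    constant-beyond {+ n} N<n with ℕ.m≤n⇒∃[o]m+o≡n (ℕ.<⇒≤ N<n)
    ... | d , refl = inj₁ (trans (cong (σ ∘ +_) (ℕ.+-comm N d)) (constant-pos d))
    constant-beyond { -[1+ n ]} (s≤s N≤n) with ℕ.m≤n⇒∃[o]m+o≡n N≤n
    ... | d , refl = inj₂ (trans (cong (σ ∘ -_ ∘ +_ ∘ suc) (ℕ.+-comm N d)) (constant-neg (suc d)))

    odd-jumps : ∀ {k l} → N ℕ.< ∣ k ∣ → N ℕ.< ∣ l ∣ → σ k ≢ σ l →
                ℕ.parity (jumps (centredRange N)) ≡ 1ℙ
    odd-jumps {k} {l} k-far l-far σk≢σl = trans (parity-jumps-centredRange N) (≢⇒+≡1ℙ ends-differ)
      where
      ends-differ : σ (- + N) ≢ σ (+ N)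
      ends-differ σ-N≡σN = σk≢σl (trans (at-end (constant-beyond k-far)) (sym (at-end (constant-beyond l-far))))
        where
        at-end : ∀ {p} → p ≡ σ (+ N) ⊎ p ≡ σ (- + N) → p ≡ σ (+ N)
        at-end (inj₁ p≡σN)  = p≡σN
        at-end (inj₂ p≡σ-N) = trans p≡σ-N σ-N≡σN

-- Two-valent graphs on ℤ

-- The vertex + (1 + Σ ∣F∣) lies outside F, yet connectivity reaches it from x.
¬closed-finite : ∀ {H : ℤ → ℤ → Set} → Connected H →
                 ∀ {x} (F : List ℤ) → x ∈ F → (∀ {u v} → u ∈ F → H u v → v ∈ F) → ⊥
¬closed-finite {H} connected {x} F x∈F closed = ℕ.<-irrefl refl (∣∣≤sum F (reach (connected x far) x∈F))
  where
  far = + suc (sum (map ∣_∣ F))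
  reach : ∀ {u v} → Star H u v → u ∈ F → v ∈ F
  reach ε          u∈F = u∈F
  reach (uv ◅ vw) u∈F = reach vw (closed u∈F uv)

record Link (H : ℤ → ℤ → Set) (p x q : ℤ) : Set where
  field
    back     : H x p
    fore     : H x q
    distinct : p ≢ q
    only     : ∀ {y} → H x y → y ≡ p ⊎ y ≡ q

module _ {H : ℤ → ℤ → Set} where

  link-swap : ∀ {p x q} → Link H p x q → Link H q x p
  link-swap l = record { back = fore ; fore = back ; distinct = distinct ∘ sym ; only = Sum.swap ∘ only }
    where open Link l

  link-fore-unique : ∀ {p x q q′} → Link H p x q → Link H p x q′ → q ≡ q′
  link-fore-unique l l′ with Link.only l (Link.fore l′)
  ... | inj₁ q′≡p = contradiction (sym q′≡p) (Link.distinct l′)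
  ... | inj₂ q′≡q = sym q′≡q

  two-valent⇒link : TwoValent H → ∀ x → ∃ λ p → ∃ λ q → Link H p x q
  two-valent⇒link two-valent x with two-valent x
  ... | a , b , a≢b , xa , xb , only = a , b , record { back = xa ; fore = xb ; distinct = a≢b ; only = only _ }

  two-valent⇒decidable : TwoValent H → Decidable₂ H
  two-valent⇒decidable two-valent x y with two-valent⇒link two-valent x
  ... | p , q , l with y ℤ.≟ p | y ℤ.≟ q
  ...   | yes refl | _        = yes (Link.back l)
  ...   | no _     | yes refl = yes (Link.fore l)
  ...   | no y≢p   | no y≢q   = no (Sum.[ y≢p , y≢q ]′ ∘ Link.only l)

  turn : TwoValent H → ∀ {x p} → H x p → ∃ λ q → Link H p x q
  turn two-valent {x} {p} xp with two-valent⇒link two-valent x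
  ... | a , b , l with p ℤ.≟ a | Link.only l xp
  ...   | yes refl | _         = b , l
  ...   | no p≢a   | inj₁ p≡a  = contradiction p≡a p≢a
  ...   | no _     | inj₂ refl = a , link-swap l

  length-filter-link : ∀ {Q : ℤ → Set} (Q? : Decidable Q) {p x q} → Link H p x q →
                       (∀ {y} → Q y ⇔ H x y) → ∀ {xs} → Unique xs → p ∈ xs → q ∈ xs →
                       length (filter Q? xs) ≡ 2
  length-filter-link Q? {p} {x} {q} l Q⇔H {xs} unique p∈ q∈ =
    length-cong-unique (Unique.filter⁺ Q? unique) ((Link.distinct l ∷ []) ∷ [] ∷ []) (mk⇔ to from)
    where
    to : ∀ {y} → y ∈ filter Q? xs → y ∈ p ∷ q ∷ []
    to y∈ with Link.only l (Equivalence.to Q⇔H (proj₂ (∈-filter⁻ Q? {xs = xs} y∈)))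
    ... | inj₁ y≡p = here y≡p
    ... | inj₂ y≡q = there (here y≡q)
    from : ∀ {y} → y ∈ p ∷ q ∷ [] → y ∈ filter Q? xs
    from (here refl)         = ∈-filter⁺ Q? p∈ (Equivalence.from Q⇔H (Link.back l))
    from (there (here refl)) = ∈-filter⁺ Q? q∈ (Equivalence.from Q⇔H (Link.fore l))

record Traversal (H : ℤ → ℤ → Set) : Set where
  field
    vertex     : ℤ → ℤ
    link       : ∀ k → Link H (vertex (ℤ.pred k)) (vertex k) (vertex (ℤ.suc k))
    injective  : ∀ {i j} → vertex i ≡ vertex j → i ≡ j
    surjective : ∀ v → ∃ λ k → vertex k ≡ v

module Walk {H : ℤ → ℤ → Set} (H-sym : ∀ {u v} → H u v → H v u) (two-valent : TwoValent H) where

  record Arc : Set where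
    constructor arc
    field
      prev cur : ℤ
      edge     : H cur prev
  open Arc

  next : Arc → Arc
  next (arc p x xp) = arc x (proj₁ (turn two-valent xp)) (H-sym (Link.fore (proj₂ (turn two-valent xp))))

  link-next : ∀ a → Link H (prev a) (cur a) (cur (next a))
  link-next (arc p x xp) = proj₂ (turn two-valent xp)

  private
    a₀ b₀ : ℤ
    a₀ = proj₁ (two-valent⇒link two-valent 0ℤ)
    b₀ = proj₁ (proj₂ (two-valent⇒link two-valent 0ℤ))
    link₀ : Link H a₀ 0ℤ b₀
    link₀ = proj₂ (proj₂ (two-valent⇒link two-valent 0ℤ))

  forward backward : ℕ → Arc
  forward  = fold (arc a₀ 0ℤ (Link.back link₀)) next
  backward = fold (arc b₀ 0ℤ (Link.fore link₀)) next

  walk : ℤ → ℤ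
  walk (+ n)    = cur (forward n)
  walk -[1+ n ] = cur (backward (suc n))

  -- The clauses are split so that ℤ.pred and ℤ.suc compute on the argument.
  walk-link : ∀ k → Link H (walk (ℤ.pred k)) (walk k) (walk (ℤ.suc k))
  walk-link (+ zero)     = subst (λ p → Link H p 0ℤ (walk 1ℤ))
    (link-fore-unique (link-swap link₀) (link-next (backward 0))) (link-next (forward 0))
  walk-link (+ suc n)    = link-next (forward (suc n))
  walk-link -[1+ zero ]  = link-swap (link-next (backward 1))
  walk-link -[1+ suc n ] = link-swap (link-next (backward (suc (suc n))))

module _ {H : ℤ → ℤ → Set} (loopless : ∀ {x} → ¬ H x x) (connected : Connected H)
         (w : ℤ → ℤ) (link : ∀ k → Link H (w (ℤ.pred k)) (w k) (w (ℤ.suc k))) where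

  link-sequence-surjective : ∀ v → ∃ λ k → w k ≡ v
  link-sequence-surjective v = reach (connected (w 0ℤ) v) (0ℤ , refl)
    where
    reach : ∀ {u v} → Star H u v → (∃ λ k → w k ≡ u) → ∃ λ k → w k ≡ v
    reach ε found = found
    reach (uv ◅ rest) (k , refl) with Link.only (link k) uv
    ... | inj₁ refl = reach rest (ℤ.pred k , refl)
    ... | inj₂ refl = reach rest (ℤ.suc k , refl)

  private
    segment : ℤ → ℕ → List ℤ
    segment i n = map (λ j → w (i ⊕ j)) (upTo (suc n))

    ∈-segment : ∀ {i n j} → j ℕ.≤ n → w (i ⊕ j) ∈ segment i n
    ∈-segment j≤n = ∈-map⁺ _ (∈-upTo⁺ (s≤s j≤n))

    segment-closed : ∀ i n → w (i ⊕ n) ≡ w (ℤ.pred i) → w (i ⊕ suc n) ≡ w i →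
                     ∀ {u v} → u ∈ segment i n → H u v → v ∈ segment i n
    segment-closed i n first last u∈ uv with ∈-map⁻ _ u∈
    ... | j , j∈ , refl = neighbour j (ℕ.≤-pred (∈-upTo⁻ j∈)) (Link.only (link (i ⊕ j)) uv)
      where
      neighbour : ∀ {v} j → j ℕ.≤ n → v ≡ w (ℤ.pred (i ⊕ j)) ⊎ v ≡ w (ℤ.suc (i ⊕ j)) →
                  v ∈ segment i n
      neighbour zero    _   (inj₁ refl) = subst (_∈ segment i n) first (∈-segment ℕ.≤-refl)
      neighbour (suc j) j<n (inj₁ refl) =
        subst (λ k → w k ∈ segment i n) (sym (ℤ.pred-suc (i ⊕ j))) (∈-segment (ℕ.<⇒≤ j<n))
      neighbour j j≤n (inj₂ refl) with suc j ℕ.≤? n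
      ... | yes j<n = ∈-segment j<n
      ... | no  j≮n with ℕ.≤-antisym j≤n (ℕ.≮⇒≥ j≮n)
      ...   | refl = subst (_∈ segment i n) (sym last) (∈-segment z≤n)

    -- If w i = w t with t = i ⊕ (d + 3), the vertex before w t is a neighbour of w i: either it is
    -- w (suc i), a shorter repetition, or it is w (pred i) and w i, …, w (t - 1) form a finite cycle.
    no-repeat : ∀ d i → w i ≢ w (i ⊕ suc d)
    no-repeat zero       i wi≡ = loopless (subst (H (w i)) (sym wi≡) (Link.fore (link i)))
    no-repeat (suc zero) i wi≡ = Link.distinct (link (ℤ.suc i)) (trans (cong w (ℤ.pred-suc i)) wi≡)
    no-repeat (suc (suc d)) i wi≡ with Link.only (link i) before-end
      where
      before-end : H (w i) (w (i ⊕ suc (suc d)))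
      before-end = subst₂ H (sym wi≡) (cong w (ℤ.pred-suc _)) (Link.back (link (i ⊕ suc (suc (suc d)))))
    ... | inj₁ cycle   = ¬closed-finite connected (segment i (suc (suc d))) (∈-segment z≤n)
                           (segment-closed i (suc (suc d)) cycle (sym wi≡))
    ... | inj₂ shorter = no-repeat d (ℤ.suc i) (trans (sym shorter) (cong w (sym (suc⊕ i (suc d)))))

  link-sequence-injective : ∀ {i j} → w i ≡ w j → i ≡ j
  link-sequence-injective {i} {j} wi≡wj with ⊕-reach i j
  ... | inj₁ (zero  , refl) = refl
  ... | inj₁ (suc d , refl) = contradiction wi≡wj (no-repeat d i)
  ... | inj₂ (zero  , refl) = refl
  ... | inj₂ (suc d , refl) = contradiction (sym wi≡wj) (no-repeat d j)

hamiltonPath⇒traversal : ∀ {S H} → NonZeroSet S → IsHamiltonPath S H → Traversal H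
hamiltonPath⇒traversal {S} {H} nonzero (subgraph , two-valent , connected) = record
  { vertex     = walk
  ; link       = walk-link
  ; injective  = link-sequence-injective loopless connected walk walk-link
  ; surjective = link-sequence-surjective loopless connected walk walk-link
  }
  where
  open Walk (λ {u} {v} → IsSubgraph.symm subgraph u v) two-valent
  loopless : ∀ {x} → ¬ H x x
  loopless {x} xx = nonzero (x - x) (IsSubgraph.sub subgraph x x xx) (ℤ.+-inverseʳ x)

-- Cut edges

side : ℤ → Parity
side (+ suc _) = 1ℙ
side (+ zero)  = 0ℙ
side -[1+ _ ]  = 0ℙ

side-neg : ∀ j → side (- + j) ≡ 0ℙ
side-neg zero    = refl
side-neg (suc j) = refl

side-neg+pos : ∀ {j n} → j ℕ.< n → side (- + j + + n) ≡ 1ℙ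
side-neg+pos {zero}  {suc n} _ = refl
side-neg+pos {suc j} {suc n} (s≤s j<n) =
  trans (cong side (trans (ℤ.[1+m]⊖[1+n]≡m⊖n n j) (sym (ℤ.-m+n≡n⊖m j n)))) (side-neg+pos j<n)

cut-shape : ∀ {u v} → side u ≡ 0ℙ → side v ≡ 1ℙ →
            ∃ λ j → ∃ λ m → u ≡ - + j × v ≡ + suc m × v - u ≡ + (suc m ℕ.+ j)
cut-shape {+ zero}    {+ suc m} _ _ = 0 , m , refl , refl , refl
cut-shape { -[1+ j ]} {+ suc m} _ _ = suc j , m , refl , refl , refl

cut-endpoints-bounded : ∀ {u v} → side u ≡ 0ℙ → side v ≡ 1ℙ →
                        ∣ u ∣ ℕ.≤ ∣ v - u ∣ × ∣ v ∣ ℕ.≤ ∣ v - u ∣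
cut-endpoints-bounded u≤0 0<v with cut-shape u≤0 0<v
... | j , m , refl , refl , v-u≡ rewrite v-u≡ =
  subst (ℕ._≤ suc m ℕ.+ j) (sym (ℤ.∣-i∣≡∣i∣ (+ j))) (ℕ.m≤n+m j (suc m)) , ℕ.m≤m+n (suc m) j

-- A pair (u , a) encodes the edge {u, u + a}; the block for a lists those with u ≤ 0 < u + a.
cutEdgesOf : List ℤ → List (ℤ × ℤ)
cutEdgesOf []       = []
cutEdgesOf (a ∷ as) = map (λ j → - + j , a) (downFrom ∣ a ∣) ++ cutEdgesOf as

Carries : (ℤ → ℤ → Set) → ℤ × ℤ → Set
Carries H (u , a) = H u (u + a)

∈-cutEdgesOf⁺ : ∀ {a j} as → a ∈ as → j ℕ.< ∣ a ∣ → (- + j , a) ∈ cutEdgesOf as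
∈-cutEdgesOf⁺ (a ∷ as) (here refl)  j<a = ∈-++⁺ˡ (∈-map⁺ (λ j → - + j , a) (∈-downFrom⁺ j<a))
∈-cutEdgesOf⁺ (b ∷ as) (there a∈as) j<a = ∈-++⁺ʳ _ (∈-cutEdgesOf⁺ as a∈as j<a)

∈-cutEdgesOf⁻ : ∀ {u a} as → (u , a) ∈ cutEdgesOf as → a ∈ as × ∃ λ j → j ℕ.< ∣ a ∣ × u ≡ - + j
∈-cutEdgesOf⁻ (b ∷ as) e∈ with ∈-++⁻ (map (λ j → - + j , b) (downFrom ∣ b ∣)) e∈
... | inj₁ e∈b with ∈-map⁻ (λ j → - + j , b) e∈b
...   | j , j∈ , refl = here refl , j , ∈-downFrom⁻ j∈ , refl
∈-cutEdgesOf⁻ (b ∷ as) e∈ | inj₂ e∈as with ∈-cutEdgesOf⁻ as e∈as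
...   | a∈as , rest = there a∈as , rest

cutEdgesOf-unique : ∀ {as} → Unique as → Unique (cutEdgesOf as)
cutEdgesOf-unique {[]}     []               = []
cutEdgesOf-unique {a ∷ as} (a∉as ∷ unique) =
  Unique.++⁺ (Unique.map⁺ (ℤ.+-injective ∘ ℤ.neg-injective ∘ cong proj₁) (Unique.downFrom⁺ ∣ a ∣))
             (cutEdgesOf-unique unique) a∉cutEdges
  where
  a∉cutEdges : ∀ {e} → ¬ (e ∈ map (λ j → - + j , a) (downFrom ∣ a ∣) × e ∈ cutEdgesOf as)
  a∉cutEdges (e∈a , e∈as) with ∈-map⁻ _ e∈a
  ... | _ , _ , refl = All.lookup a∉as (proj₁ (∈-cutEdgesOf⁻ as e∈as)) refl

length-cutEdgesOf : ∀ {as} → All (0ℤ ℤ.<_) as → + length (cutEdgesOf as) ≡ sumℤ as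
length-cutEdgesOf {[]}     []            = refl
length-cutEdgesOf {a ∷ as} (0<a ∷ 0<as) = begin
  + length (cutEdgesOf (a ∷ as))
    ≡⟨ cong +_ (length-++ (map (λ j → - + j , a) (downFrom ∣ a ∣))) ⟩
  + (length (map (λ j → - + j , a) (downFrom ∣ a ∣)) ℕ.+ length (cutEdgesOf as))
    ≡⟨ cong (λ n → + (n ℕ.+ length (cutEdgesOf as)))
            (trans (length-map _ (downFrom ∣ a ∣)) (length-downFrom ∣ a ∣)) ⟩
  + ∣ a ∣ + + length (cutEdgesOf as)
    ≡⟨ cong₂ _+_ (ℤ.0≤i⇒+∣i∣≡i (ℤ.<⇒≤ 0<a)) (length-cutEdgesOf 0<as) ⟩
  a + sumℤ as ∎
  where open ≡-Reasoning

module _ {S : ZSet} {L : List ℤ} (enumerates : Enumerates S L) where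

  cutEdges : List (ℤ × ℤ)
  cutEdges = cutEdgesOf (positives L)

  ∈-cutEdges⁻ : ∀ {u a} → (u , a) ∈ cutEdges → S a × side u ≡ 0ℙ × side (u + a) ≡ 1ℙ
  ∈-cutEdges⁻ e∈ with ∈-cutEdgesOf⁻ (positives L) e∈
  ... | a∈pos , j , j<a , refl with ∈-filter⁻ (0ℤ ℤ.<?_) {xs = L} a∈pos
  ...   | a∈L , ℤ.+<+ {n = suc m} _ = proj₂ (proj₂ enumerates _) a∈L , side-neg j , side-neg+pos j<a

  ∈-cutEdges⁺ : ∀ {u a} → S a → side u ≡ 0ℙ → side (u + a) ≡ 1ℙ → (u , a) ∈ cutEdges
  ∈-cutEdges⁺ {u} {a} Sa u≤0 0<u+a with cut-shape u≤0 0<u+a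
  ... | j , m , refl , _ , u+a-u≡ with trans (sym ([u+a]-u≡a u a)) u+a-u≡
  ...   | refl = ∈-cutEdgesOf⁺ (positives L)
                   (∈-filter⁺ (0ℤ ℤ.<?_) (proj₁ (proj₂ enumerates _) Sa) (ℤ.+<+ (s≤s z≤n)))
                   (s≤s (ℕ.m≤n+m j m))

CutEdge : (ℤ → ℤ → Set) → ℤ × ℤ → Set
CutEdge H (u , v) = side u ≡ 0ℙ × side v ≡ 1ℙ × H u v

-- Applied to side x, this lists the non-positive endpoint of a crossing edge first.
order : Parity → ℤ → ℤ → ℤ × ℤ
order 0ℙ x y = x , y
order 1ℙ x y = y , x

order-endpoints : ∀ p x y → order p x y ≡ (x , y) ⊎ order p x y ≡ (y , x)
order-endpoints 0ℙ x y = inj₁ refl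
order-endpoints 1ℙ x y = inj₂ refl

order-cut : ∀ {H} → (∀ {u v} → H u v → H v u) →
            ∀ x y → side x ℙ.+ side y ≡ 1ℙ → H x y → CutEdge H (order (side x) x y)
order-cut H-sym x y crossing xy with side x in sx | side y in sy
... | 0ℙ | 1ℙ = sx , sy , xy
... | 1ℙ | 0ℙ = sy , sx , H-sym xy
... | 0ℙ | 0ℙ = contradiction crossing λ ()
... | 1ℙ | 1ℙ = contradiction crossing λ ()

toEdge : ℤ × ℤ → ℤ × ℤ
toEdge (u , v) = u , v - u

toEdge-injective : ∀ {e e′} → toEdge e ≡ toEdge e′ → e ≡ e′
toEdge-injective {u , v} {u′ , v′} eq = cong₂ _,_ (cong proj₁ eq)
  (trans (sym (u+[v-u]≡v u v)) (trans (cong₂ _+_ (cong proj₁ eq) (cong proj₂ eq)) (u+[v-u]≡v u′ v′)))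

-- A Hamilton path contains an odd number of cut edges

module PathCut {S : ZSet} {L : List ℤ} (enumerates : Enumerates S L) (nonzero : NonZeroSet S)
               {H : ℤ → ℤ → Set} (path : IsHamiltonPath S H) where

  open Traversal (hamiltonPath⇒traversal nonzero path) renaming (vertex to w)
  private
    subgraph = proj₁ path
    H-sym : ∀ {u v} → H u v → H v u
    H-sym {u} {v} = IsSubgraph.symm subgraph u v

  σ : ℤ → Parity
  σ = side ∘ w
  open SignChanges σ

  ends : ℤ → ℤ × ℤ
  ends k = order (σ k) (w k) (w (ℤ.suc k))

  private
    two-apart : ∀ {i j} → (w i , w (ℤ.suc i)) ≢ (w (ℤ.suc j) , w j)
    two-apart {i} {j} eq with injective {i} {ℤ.suc j} (cong proj₁ eq) | injective {ℤ.suc i} {j} (cong proj₂ eq)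
    ... | refl | j+2≡j = ℤ.<-irrefl (sym j+2≡j) (ℤ.suc[i]≤j⇒i<j (ℤ.i≤suc[i] (ℤ.suc j)))

    suc-injective : ∀ {i j} → ℤ.suc i ≡ ℤ.suc j → i ≡ j
    suc-injective {i} {j} eq = trans (sym (ℤ.pred-suc i)) (trans (cong ℤ.pred eq) (ℤ.pred-suc j))

  ends-injective : ∀ {k k′} → ends k ≡ ends k′ → k ≡ k′
  ends-injective {k} {k′} eq
    with order-endpoints (σ k) (w k) (w (ℤ.suc k)) | order-endpoints (σ k′) (w k′) (w (ℤ.suc k′))
  ... | inj₁ e | inj₁ e′ = injective (cong proj₁ (trans (sym e) (trans eq e′)))
  ... | inj₂ e | inj₂ e′ = suc-injective (injective (cong proj₁ (trans (sym e) (trans eq e′))))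
  ... | inj₁ e | inj₂ e′ = contradiction (trans (sym e) (trans eq e′)) (two-apart {k} {k′})
  ... | inj₂ e | inj₁ e′ = contradiction (trans (sym e′) (trans (sym eq) e)) (two-apart {k′} {k})

  jump-ends : ∀ k → Jump k → CutEdge H (ends k)
  jump-ends k jump = order-cut {H} H-sym (w k) (w (ℤ.suc k)) jump (Link.fore (link k))

  private
    traversed : ∀ k {u v} → side u ≡ 0ℙ → side v ≡ 1ℙ →
                (w k ≡ u × w (ℤ.suc k) ≡ v) ⊎ (w k ≡ v × w (ℤ.suc k) ≡ u) → Jump k × ends k ≡ (u , v)
    traversed k u≤0 0<v (inj₁ (refl , refl)) rewrite u≤0 | 0<v = refl , refl
    traversed k u≤0 0<v (inj₂ (refl , refl)) rewrite u≤0 | 0<v = refl , refl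

  cut-edge-ends : ∀ {e} → CutEdge H e → ∃ λ k → Jump k × ends k ≡ e
  cut-edge-ends {u , v} (u≤0 , 0<v , uv) with surjective u
  ... | k , refl with Link.only (link k) uv
  ...   | inj₂ refl = k , traversed k u≤0 0<v (inj₁ (refl , refl))
  ...   | inj₁ refl = ℤ.pred k , traversed (ℤ.pred k) u≤0 0<v (inj₂ (refl , cong w (ℤ.suc-pred k)))

  -- R bounds the length of every edge, N bounds the index of every vertex in [-R, R],
  -- and W bounds every vertex whose index lies in [-N, N].
  private
    R : ℕ
    R = sum (map ∣_∣ L)

    idx : ℤ → ℤ
    idx v = proj₁ (surjective v)

    N : ℕ
    N = proj₁ (bounded-on-ball idx R)

    W : ℕ
    W = proj₁ (bounded-on-ball w N)

    index-bounded : ∀ k → ∣ w k ∣ ℕ.≤ R → ∣ k ∣ ℕ.≤ N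
    index-bounded k ∣wk∣≤R = subst (λ i → ∣ i ∣ ℕ.≤ N) (injective {idx (w k)} {k} (proj₂ (surjective (w k))))
                                   (proj₂ (bounded-on-ball idx R) {w k} ∣wk∣≤R)

    cut-bounded : ∀ {e} → CutEdge H e → ∣ proj₁ e ∣ ℕ.≤ R × ∣ proj₂ e ∣ ℕ.≤ R
    cut-bounded {u , v} (u≤0 , 0<v , uv) with cut-endpoints-bounded u≤0 0<v
    ... | ∣u∣≤ , ∣v∣≤ = ℕ.≤-trans ∣u∣≤ ∣v-u∣≤R , ℕ.≤-trans ∣v∣≤ ∣v-u∣≤R
      where
      ∣v-u∣≤R = ∣∣≤sum L (proj₁ (proj₂ enumerates _) (IsSubgraph.sub subgraph u v uv))

    bounded-either-way : ∀ {x y} e → e ≡ (x , y) ⊎ e ≡ (y , x) →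
                         ∣ proj₁ e ∣ ℕ.≤ R × ∣ proj₂ e ∣ ℕ.≤ R → ∣ x ∣ ℕ.≤ R × ∣ y ∣ ℕ.≤ R
    bounded-either-way _ (inj₁ refl) (∣x∣≤R , ∣y∣≤R) = ∣x∣≤R , ∣y∣≤R
    bounded-either-way _ (inj₂ refl) (∣y∣≤R , ∣x∣≤R) = ∣x∣≤R , ∣y∣≤R

    jump-bounded : ∀ k → Jump k → ∣ k ∣ ℕ.≤ N × ∣ ℤ.suc k ∣ ℕ.≤ N
    jump-bounded k jump with bounded-either-way (ends k) (order-endpoints (σ k) (w k) (w (ℤ.suc k)))
                                                (cut-bounded {ends k} (jump-ends k jump))
    ... | ∣wk∣≤R , ∣wk+1∣≤R = index-bounded k ∣wk∣≤R , index-bounded (ℤ.suc k) ∣wk+1∣≤R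

    far-index : ∀ v → W ℕ.< ∣ v ∣ → N ℕ.< ∣ idx v ∣
    far-index v W<∣v∣ = ℕ.≰⇒> λ ∣idx∣≤N →
      ℕ.<⇒≱ W<∣v∣ (subst (λ x → ∣ x ∣ ℕ.≤ W) (proj₂ (surjective v))
                         (proj₂ (bounded-on-ball w N) {idx v} ∣idx∣≤N))

    odd-jumps-in-path : ℕ.parity (jumps (centredRange N)) ≡ 1ℙ
    odd-jumps-in-path = odd-jumps jump-bounded {idx (+ suc W)} {idx -[1+ W ]}
      (far-index (+ suc W) ℕ.≤-refl) (far-index -[1+ W ] ℕ.≤-refl)
      (λ σ⁺≡σ⁻ → 1ℙ≢0ℙ (trans (sym (cong side (proj₂ (surjective (+ suc W)))))
                          (trans σ⁺≡σ⁻ (cong side (proj₂ (surjective -[1+ W ]))))))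
      where
      1ℙ≢0ℙ : 1ℙ ≢ 0ℙ
      1ℙ≢0ℙ ()

  carries? : Decidable (Carries H)
  carries? (u , a) = two-valent⇒decidable (proj₁ (proj₂ path)) u (u + a)

  pathCutEdges : List (ℤ × ℤ)
  pathCutEdges = filter carries? (cutEdges enumerates)

  private
    jumpEdges : List (ℤ × ℤ)
    jumpEdges = map (toEdge ∘ ends) (filter jump? (centredRange N))

    jumpEdges-unique : Unique jumpEdges
    jumpEdges-unique = Unique.map⁺ (ends-injective ∘ toEdge-injective) (Unique.filter⁺ jump? (centredRange-unique N))

    pathCutEdges-unique : Unique pathCutEdges
    pathCutEdges-unique = Unique.filter⁺ carries? (cutEdgesOf-unique (Unique.filter⁺ (0ℤ ℤ.<?_) (proj₁ enumerates)))

    pathCutEdges⊆jumpEdges : ∀ {e} → e ∈ pathCutEdges → e ∈ jumpEdges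
    pathCutEdges⊆jumpEdges {u , a} e∈ with ∈-filter⁻ carries? {xs = cutEdges enumerates} e∈
    ... | e∈cut , carried with ∈-cutEdges⁻ enumerates e∈cut
    ...   | _ , u≤0 , 0<u+a with cut-edge-ends (u≤0 , 0<u+a , carried)
    ...     | k , jump , ends≡ =
      subst (_∈ jumpEdges) (trans (cong toEdge ends≡) (cong (u ,_) ([u+a]-u≡a u a)))
        (∈-map⁺ (toEdge ∘ ends) {k} (∈-filter⁺ jump? (jump∈centredRange jump-bounded jump) jump))

    toEdge-cut∈pathCutEdges : ∀ {e} → CutEdge H e → toEdge e ∈ pathCutEdges
    toEdge-cut∈pathCutEdges {u , v} (u≤0 , 0<v , uv) = ∈-filter⁺ carries?
      (∈-cutEdges⁺ enumerates (IsSubgraph.sub subgraph u v uv) u≤0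
        (subst (λ x → side x ≡ 1ℙ) (sym (u+[v-u]≡v u v)) 0<v))
      (subst (H u) (sym (u+[v-u]≡v u v)) uv)

    jumpEdges⊆pathCutEdges : ∀ {e} → e ∈ jumpEdges → e ∈ pathCutEdges
    jumpEdges⊆pathCutEdges e∈ with ∈-map⁻ (toEdge ∘ ends) e∈
    ... | k , k∈ , refl =
      toEdge-cut∈pathCutEdges {ends k} (jump-ends k (proj₂ (∈-filter⁻ jump? {xs = centredRange N} k∈)))

  odd-pathCutEdges : ℕ.parity (length pathCutEdges) ≡ 1ℙ
  odd-pathCutEdges = begin
    ℕ.parity (length pathCutEdges)
      ≡⟨ cong ℕ.parity (length-cong-unique pathCutEdges-unique jumpEdges-unique
                          (mk⇔ pathCutEdges⊆jumpEdges jumpEdges⊆pathCutEdges)) ⟩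
    ℕ.parity (length jumpEdges)
      ≡⟨ cong ℕ.parity (length-map (toEdge ∘ ends) (filter jump? (centredRange N))) ⟩
    ℕ.parity (jumps (centredRange N))
      ≡⟨ odd-jumps-in-path ⟩
    1ℙ ∎
    where open ≡-Reasoning

-- Counting over a Hamilton decomposition

module _ {S : ZSet} (inverse-closed : InverseClosed S) (nonzero : NonZeroSet S)
         {L : List ℤ} (enumerates : Enumerates S L) where

  private
    S⇒∈ : ∀ {x} → S x → x ∈ L
    S⇒∈ = proj₁ (proj₂ enumerates _)

    ∈⇒S : ∀ {x} → x ∈ L → S x
    ∈⇒S = proj₂ (proj₂ enumerates _)

    non-positives≐negated-positives : ∀ {x} → x ∈ filter (¬? ∘ (0ℤ ℤ.<?_)) L ⇔ x ∈ map -_ (positives L)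
    non-positives≐negated-positives = mk⇔ to from
      where
      0<-x : ∀ x → ¬ 0ℤ ℤ.< x → x ≢ 0ℤ → 0ℤ ℤ.< - x
      0<-x (+ zero)  _   x≢0 = contradiction refl x≢0
      0<-x (+ suc n) x≯0 _   = contradiction (ℤ.+<+ (s≤s z≤n)) x≯0
      0<-x -[1+ n ]  _   _   = ℤ.+<+ (s≤s z≤n)
      to : ∀ {x} → x ∈ filter (¬? ∘ (0ℤ ℤ.<?_)) L → x ∈ map -_ (positives L)
      to {x} x∈ with ∈-filter⁻ (¬? ∘ (0ℤ ℤ.<?_)) {xs = L} x∈
      ... | x∈L , x≯0 = subst (_∈ map -_ (positives L)) (ℤ.neg-involutive x)
        (∈-map⁺ -_ (∈-filter⁺ (0ℤ ℤ.<?_) (S⇒∈ (proj₁ (inverse-closed x) (∈⇒S x∈L)))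
                                          (0<-x x x≯0 (nonzero x (∈⇒S x∈L)))))
      from : ∀ {x} → x ∈ map -_ (positives L) → x ∈ filter (¬? ∘ (0ℤ ℤ.<?_)) L
      from x∈ with ∈-map⁻ -_ x∈
      ... | y , y∈ , refl with ∈-filter⁻ (0ℤ ℤ.<?_) {xs = L} y∈
      ...   | y∈L , ℤ.+<+ {n = suc n} _ =
        ∈-filter⁺ (¬? ∘ (0ℤ ℤ.<?_)) (S⇒∈ (proj₁ (inverse-closed _) (∈⇒S y∈L))) λ ()

  length≡2*length-positives : length L ≡ 2 ℕ.* length (positives L)
  length≡2*length-positives = begin
    length L
      ≡⟨ length-filter-split (0ℤ ℤ.<?_) L ⟩
    length (positives L) ℕ.+ length (filter (¬? ∘ (0ℤ ℤ.<?_)) L)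
      ≡⟨ cong (length (positives L) ℕ.+_) (length-cong-unique (Unique.filter⁺ _ (proj₁ enumerates))
           (Unique.map⁺ ℤ.neg-injective (Unique.filter⁺ _ (proj₁ enumerates))) non-positives≐negated-positives) ⟩
    length (positives L) ℕ.+ length (map -_ (positives L))
      ≡⟨ cong (length (positives L) ℕ.+_) (trans (length-map -_ (positives L)) (sym (ℕ.+-identityʳ _))) ⟩
    2 ℕ.* length (positives L) ∎
    where open ≡-Reasoning

module Decomposition {S : ZSet} (nonzero : NonZeroSet S) {L : List ℤ} (enumerates : Enumerates S L)
                     {I : Set} {P : I → ℤ → ℤ → Set} (decomposition : IsHamiltonDecomposition S I P) where

  private
    paths    = proj₁ decomposition
    disjoint = proj₁ (proj₂ decomposition)
    cover    = proj₂ (proj₂ decomposition)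

    S? : Decidable S
    S? x = map′ (proj₂ (proj₂ enumerates x)) (proj₁ (proj₂ enumerates x)) (x ∈? L)

    carries? : ∀ i → Decidable (Carries (P i))
    carries? i = PathCut.carries? enumerates nonzero (paths i)

    carried : ∀ {u a} → S a → ∃ λ i → Carries (P i) (u , a)
    carried {u} {a} Sa = cover u (u + a) (subst S (sym ([u+a]-u≡a u a)) Sa)

    same-carrier : ∀ {i j e} → Carries (P i) e → Carries (P j) e → i ≡ j
    same-carrier {i} {j} {u , a} = disjoint i j u (u + a)

  SamePath : ℤ × ℤ → ℤ × ℤ → Set
  SamePath e e′ = ∃ λ i → Carries (P i) e × Carries (P i) e′

  same-path? : Decidable₂ SamePath
  same-path? (u , a) e′ with S? a
  ... | no ¬Sa = no λ (i , ua , _) → ¬Sa (subst S ([u+a]-u≡a u a) (IsSubgraph.sub (proj₁ (paths i)) u (u + a) ua))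
  ... | yes Sa with carried {u} Sa
  ...   | i , ua with carries? i e′
  ...     | yes e′∈i = yes (i , ua , e′∈i)
  ...     | no  e′∉i = no λ (j , ua′ , e′∈j) →
    e′∉i (subst (λ i → Carries (P i) e′) (same-carrier ua′ ua) e′∈j)

  same-path-sym : Symmetric SamePath
  same-path-sym (i , e∈i , e′∈i) = i , e′∈i , e∈i

  same-path-trans : Transitive SamePath
  same-path-trans (i , e∈i , e′∈i) (j , e′∈j , e″∈j) =
    i , e∈i , subst (λ k → Carries (P k) _) (same-carrier e′∈j e′∈i) e″∈j

  from0 : ℤ → ℤ × ℤ
  from0 a = 0ℤ , a

  edgesAt0 : List (ℤ × ℤ)
  edgesAt0 = map from0 L

  -- Counting each cut edge twice, every path has weight 2·odd + 2, a multiple of 4.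
  weightedEdges : List (ℤ × ℤ)
  weightedEdges = cutEdges enumerates ++ cutEdges enumerates ++ edgesAt0

  private
    weightedEdge-S : ∀ {e} → e ∈ weightedEdges → S (proj₂ e)
    weightedEdge-S {u , a} e∈ with ∈-++⁻ (cutEdges enumerates) e∈
    ... | inj₁ e∈cut = proj₁ (∈-cutEdges⁻ enumerates e∈cut)
    ... | inj₂ e∈rest with ∈-++⁻ (cutEdges enumerates) e∈rest
    ...   | inj₁ e∈cut = proj₁ (∈-cutEdges⁻ enumerates e∈cut)
    ...   | inj₂ e∈at0 with ∈-map⁻ from0 e∈at0
    ...     | x , x∈L , refl = proj₂ (proj₂ enumerates x) x∈L

    same-path-refl : ∀ {e} → e ∈ weightedEdges → SamePath e e
    same-path-refl {u , a} e∈ with carried {u} (weightedEdge-S e∈)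
    ... | i , e∈i = i , e∈i , e∈i

    length-filter-weighted : ∀ {Q : ℤ × ℤ → Set} (Q? : Decidable Q) →
      length (filter Q? weightedEdges) ≡
      length (filter Q? (cutEdges enumerates)) ℕ.+
        (length (filter Q? (cutEdges enumerates)) ℕ.+ length (filter Q? edgesAt0))
    length-filter-weighted Q? = begin
      length (filter Q? weightedEdges)
        ≡⟨ cong length (filter-++ Q? (cutEdges enumerates) _) ⟩
      length (filter Q? (cutEdges enumerates) ++ filter Q? (cutEdges enumerates ++ edgesAt0))
        ≡⟨ length-++ (filter Q? (cutEdges enumerates)) ⟩
      _ ℕ.+ length (filter Q? (cutEdges enumerates ++ edgesAt0))
        ≡⟨ cong (length (filter Q? (cutEdges enumerates)) ℕ.+_)
             (trans (cong length (filter-++ Q? (cutEdges enumerates) edgesAt0))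
                    (length-++ (filter Q? (cutEdges enumerates)))) ⟩
      _ ∎
      where open ≡-Reasoning

    edgesAt0-on-path : ∀ i → length (filter (carries? i) edgesAt0) ≡ 2
    edgesAt0-on-path i with two-valent⇒link (proj₁ (proj₂ (paths i))) 0ℤ
    ... | p , q , l = trans (length-filter-map (carries? i) from0 L)
        (length-filter-link (carries? i ∘ from0) l
          (mk⇔ (subst (P i 0ℤ) (ℤ.+-identityˡ _)) (subst (P i 0ℤ) (sym (ℤ.+-identityˡ _))))
          (proj₁ enumerates) (neighbour∈L (Link.back l)) (neighbour∈L (Link.fore l)))
      where
      neighbour∈L : ∀ {y} → P i 0ℤ y → y ∈ L
      neighbour∈L {y} 0y =
        proj₁ (proj₂ enumerates y) (subst S (ℤ.+-identityʳ y) (IsSubgraph.sub (proj₁ (paths i)) 0ℤ y 0y))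

    4∣odd+odd+2 : ∀ t → ℕ.parity t ≡ 1ℙ → 4 ℕ∣.∣ t ℕ.+ (t ℕ.+ 2)
    4∣odd+odd+2 t odd = subst (4 ℕ∣.∣_) (2*[1+t]≡t+[t+2] t) (ℕ∣.*-monoʳ-∣ 2 (odd⇒2∣suc t odd))
      where
      2*[1+t]≡t+[t+2] : ∀ t → 2 ℕ.* (1 ℕ.+ t) ≡ t ℕ.+ (t ℕ.+ 2)
      2*[1+t]≡t+[t+2] = ℕ-Solver.solve-∀

    class-size : ∀ {e} → e ∈ weightedEdges → 4 ℕ∣.∣ length (filter (same-path? e) weightedEdges)
    class-size {e} e∈ with carried {proj₁ e} (weightedEdge-S e∈)
    ... | i , e∈i =
      subst (4 ℕ∣.∣_) (sym class≡) (4∣odd+odd+2 t (PathCut.odd-pathCutEdges enumerates nonzero (paths i)))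
      where
      t = length (filter (carries? i) (cutEdges enumerates))
      class≡ : length (filter (same-path? e) weightedEdges) ≡ t ℕ.+ (t ℕ.+ 2)
      class≡ = begin
        length (filter (same-path? e) weightedEdges)
          ≡⟨ cong length (filter-≐ (same-path? e) (carries? i)
               ( (λ (j , e∈j , e′∈j) → subst (λ k → Carries (P k) _) (same-carrier e∈j e∈i) e′∈j)
               , (λ e′∈i → i , e∈i , e′∈i))
               weightedEdges) ⟩
        length (filter (carries? i) weightedEdges)
          ≡⟨ length-filter-weighted (carries? i) ⟩
        t ℕ.+ (t ℕ.+ length (filter (carries? i) edgesAt0))
          ≡⟨ cong (λ z → t ℕ.+ (t ℕ.+ z)) (edgesAt0-on-path i) ⟩
        t ℕ.+ (t ℕ.+ 2) ∎
        where open ≡-Reasoning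

  4∣2*cut+length : 4 ℕ∣.∣ length (cutEdges enumerates) ℕ.+ (length (cutEdges enumerates) ℕ.+ length L)
  4∣2*cut+length = subst (4 ℕ∣.∣_) length-weighted
    (∣classes⇒∣length same-path? same-path-sym same-path-trans 4 weightedEdges same-path-refl class-size)
    where
    length-weighted : length weightedEdges ≡ length (cutEdges enumerates) ℕ.+ (length (cutEdges enumerates) ℕ.+ length L)
    length-weighted = trans (length-++ (cutEdges enumerates))
      (cong (length (cutEdges enumerates) ℕ.+_)
        (trans (length-++ (cutEdges enumerates)) (cong (length (cutEdges enumerates) ℕ.+_) (length-map from0 L))))

even-difference : ∀ E p → 4 ℕ∣.∣ E ℕ.+ (E ℕ.+ 2 ℕ.* p) → + 2 ℤ∣.∣ (+ E - + p)
even-difference E p 4∣ = ℤ∣ₛ.∣⇒∣ᵤ (subst (+ 2 ℤ∣ₛ.∣_) [E+p]-2p≡E-p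
  (ℤ∣ₛ.∣m∣n⇒∣m-n (ℤ∣ₛ.∣ᵤ⇒∣ {+ 2} {+ (E ℕ.+ p)} 2∣E+p)
                  (ℤ∣ₛ.∣m⇒∣m*n (+ p) (ℤ∣ₛ.∣-refl {+ 2}))))
  where
  double : ∀ E p → E ℕ.+ (E ℕ.+ 2 ℕ.* p) ≡ 2 ℕ.* (E ℕ.+ p)
  double = ℕ-Solver.solve-∀
  2∣E+p : 2 ℕ∣.∣ E ℕ.+ p
  2∣E+p = ℕ∣.*-cancelˡ-∣ 2 (subst (4 ℕ∣.∣_) (double E p) 4∣)
  cancel : ∀ e q → (e + q) - + 2 ℤ.* q ≡ e - q
  cancel = solve-∀
  [E+p]-2p≡E-p : + (E ℕ.+ p) - + 2 ℤ.* + p ≡ + E - + p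
  [E+p]-2p≡E-p = trans (cong (λ x → x - + 2 ℤ.* + p) (ℤ.pos-+ E p)) (cancel (+ E) (+ p))

∣-along-walk : ∀ {H : ℤ → ℤ → Set} {k} → (∀ {u v} → H u v → k ℤ∣ₛ.∣ v - u) →
               ∀ {u v} → Star H u v → k ℤ∣ₛ.∣ u → k ℤ∣ₛ.∣ v
∣-along-walk steps ε k∣u = k∣u
∣-along-walk {k = k} steps (_◅_ {i = u} {j = v} uv rest) k∣u =
  ∣-along-walk steps rest (subst (k ℤ∣ₛ.∣_) (u+[v-u]≡v u v) (ℤ∣ₛ.∣m∣n⇒∣m+n k∣u (steps uv)))

gcd-one : ∀ {S} → HamiltonDecomposable S → (∃ λ s → S s) → GcdOne S
gcd-one {S} (I , P , paths , _ , cover) (s , Ss) d d∣S with cover 0ℤ s (subst S (sym (ℤ.+-identityʳ s)) Ss)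
... | i , _ = ℕ∣.∣1⇒≡1 (ℤ∣ₛ.∣⇒∣ᵤ (∣-along-walk steps (proj₂ (proj₂ (paths i)) 0ℤ 1ℤ)
                                              (ℤ∣ₛ.∣ᵤ⇒∣ {+ d} {0ℤ} (ℕ∣._∣0 d))))
  where
  steps : ∀ {u v} → P i u v → + d ℤ∣ₛ.∣ v - u
  steps {u} {v} uv = ℤ∣ₛ.∣ᵤ⇒∣ {+ d} (d∣S _ (IsSubgraph.sub (proj₁ (paths i)) u v uv))

lemma2 : (S : ZSet) → InverseClosed S → NonZeroSet S → HamiltonDecomposable S →
    ((∃ λ (s : ℤ) → S s) → GcdOne S) × FiniteParity S
lemma2 S inverse-closed nonzero decomposable@(I , P , decomposition) = gcd-one decomposable , finite-parity
  where
  finite-parity : FiniteParity S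
  finite-parity L enumerates =
    subst (λ Σa → + 2 ℤ∣.∣ (Σa - + length (positives L))) (length-cutEdgesOf (all-filter (0ℤ ℤ.<?_) L))
      (even-difference (length (cutEdges enumerates)) (length (positives L))
        (subst (λ n → 4 ℕ∣.∣ length (cutEdges enumerates) ℕ.+ (length (cutEdges enumerates) ℕ.+ n))
          (length≡2*length-positives inverse-closed nonzero enumerates)
          (Decomposition.4∣2*cut+length nonzero enumerates decomposition)))
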